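{- Let $P\in\mathcal{C}(G_n)$ and let $S$ be a proper, nonempty subset of $Q_n$ such that $S \in \mathrm{char}(P)$. Then the bit that changes from the first to the second row of $P$ is not in $S$.
   Context: Let $Q_n=\{1,\dots,n\}$ be a set of $n$ yes/no questions; an outcome on $S\subseteq Q_n$ is an element of $\{0,1\}^{|S|}$, and $X_S$ is the set of outcomes on $S$. A preference matrix on $Q_n$ is a $2^n\times n$ 0-1 matrix whose rows are the $2^n$ outcomes, each exactly once, ordered from most to least preferred. For a nonempty proper $S\subset Q_n$ and outcome $x$ on $Q_n-S$, $P^{[Q_n-S,x]}$ is the submatrix formed by the columns in $S$ and rows with outcome $x$ on $Q_n-S$ (in order); $S$ is separable with respect to $P$ if $P^{[Q_n-S,x]}=P^{[Q_n-S,y]}$ for all $x,y\in X_{Q_n-S}$; $\emptyset$ and $Q_n$ are always separable. The character $\mathrm{char}(P)$ is the set of all subsets of $Q_n$ separable with respect to $P$. $\mathcal{C}(G_n)$ is the set of preference matrices generated by Hamiltonian paths in the $n$-dimensional hypercube graph $G_n$ with Gray code labeling, i.e. preference matrices in which consecutive rows differ in exactly one entry (bit). -}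

module Defs where

open import Data.Nat using (ℕ; _^_)
open import Data.Bool using (Bool; true; false)
import Data.Bool as B
open import Data.Vec using (Vec; []; _∷_; lookup)
open import Data.List using (List; []; _∷_; map; filter; length)
open import Data.List.Properties using (≡-dec)
open import Data.List.Relation.Unary.Unique.Propositional using (Unique)
open import Data.List.Relation.Unary.Linked using (Linked)
import Data.List.Membership.Propositional as LM
open import Data.Fin using (Fin)
open import Data.Fin.Subset using (Subset; ∁; ⊥; ⊤)
open import Data.Product using (Σ; _×_)
open import Data.Sum using (_⊎_)
open import Relation.Binary.PropositionalEquality using (_≡_; _≢_)

Outcome : ℕ → Set
Outcome n = Vec Bool n

restrict : ∀ {n} → Subset n → Outcome n → List Bool
restrict []          []      = []
restrict (true  ∷ s) (b ∷ v) = b ∷ restrict s v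
restrict (false ∷ s) (_ ∷ v) = restrict s v

-- A preference matrix: the list of rows (most to least preferred),
-- 2^n rows, each outcome occurring exactly once.
IsPrefMatrix : ∀ n → List (Outcome n) → Set
IsPrefMatrix n P = (length P ≡ 2 ^ n) × Unique P × (∀ v → v LM.∈ P)

DifferInExactlyOne : ∀ {n} → Outcome n → Outcome n → Set
DifferInExactlyOne {n} r r' =
  Σ (Fin n) λ j → (lookup r j ≢ lookup r' j) × (∀ k → lookup r k ≢ lookup r' k → k ≡ j)

InCG : ∀ n → List (Outcome n) → Set
InCG n P = IsPrefMatrix n P × Linked DifferInExactlyOne P

-- The outcome on Q_n - S is given by any full
-- outcome x (only its restriction to ∁ S matters).
subMatrix : ∀ {n} → List (Outcome n) → Subset n → Outcome n → List (List Bool)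
subMatrix P S x =
  map (restrict S)
      (filter (λ r → ≡-dec B._≟_ (restrict (∁ S) r) (restrict (∁ S) x)) P)

Separable : ∀ {n} → Subset n → List (Outcome n) → Set
Separable S P = (S ≡ ⊥ ⊎ S ≡ ⊤) ⊎ (∀ x y → subMatrix P S x ≡ subMatrix P S y)

-- Write g r for the outcome of row r on the questions outside S; the rows with a
-- common value of g form a block. Suppose the first two rows r₀, r₁ differ in a
-- bit of S, so they lie in the same block. As S ≠ Q_n there is another block;
-- let v be the first row of P outside the block of r₀ and u the row before it.
-- Then u and v differ in a bit outside S, so they agree on S; by separability
-- v, being the first row of its block, agrees on S with r₀, the first row of
-- its own block. Hence u agrees with r₀ both on S and off S, i.e. u = r₀, which
-- is impossible since u comes after r₁.
module Submission where

open import Defs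
open import Data.Nat using (ℕ)
open import Data.Vec using ([]; _∷_; lookup; here; there)
open import Data.List using (List; []; _∷_; _++_; filter; map)
open import Data.List.Properties using (≡-dec; ∷-injective; ∷-injectiveˡ; filter-accept; filter-reject)
open import Data.List.Relation.Unary.All as All using (All; []; _∷_)
import Data.List.Relation.Unary.Any as Any
open import Data.List.Relation.Unary.AllPairs using (_∷_)
open import Data.List.Relation.Unary.Linked using (Linked; [-]; _∷_)
open import Data.List.Membership.Propositional using () renaming (_∈_ to _∈ᴸ_)
open import Data.List.Membership.Propositional.Properties using (∈-++⁺ʳ)
open import Data.Fin using (Fin; zero; suc)
open import Data.Fin.Subset using (Subset; Nonempty; ⊤; ∁; _∈_; _∉_)
open import Data.Fin.Subset.Properties using (x∈p⇒x∉∁p; ∉⊥)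
open import Data.Bool using (true; false; not)
import Data.Bool as B
open import Data.Bool.Properties using (not-¬)
open import Data.Product using (∃; _×_; _,_; proj₁; proj₂)
open import Data.Sum using (inj₁; inj₂)
open import Data.Empty using (⊥-elim)
open import Function using (_∘_)
open import Level using (_⊔_)
open import Relation.Binary using (Rel)
open import Relation.Nullary using (¬_; yes; no; contradiction)
open import Relation.Unary using (Pred; Decidable)
open import Relation.Binary.PropositionalEquality using (_≡_; _≢_; refl; sym; trans; cong; cong₂; subst; module ≡-Reasoning)

restrict-cong : ∀ {n} (T : Subset n) {r r' : Outcome n} →
                (∀ k → k ∈ T → lookup r k ≡ lookup r' k) → restrict T r ≡ restrict T r'
restrict-cong []          {[]}    {[]}    _  = refl
restrict-cong (true  ∷ T) {_ ∷ _} {_ ∷ _} eq =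
  cong₂ _∷_ (eq zero here) (restrict-cong T (λ k → eq (suc k) ∘ there))
restrict-cong (false ∷ T) {_ ∷ _} {_ ∷ _} eq = restrict-cong T (λ k → eq (suc k) ∘ there)

restrict-≡-if-differences-outside : ∀ {n} (T : Subset n) {r r' : Outcome n} →
  (∀ k → lookup r k ≢ lookup r' k → k ∉ T) → restrict T r ≡ restrict T r'
restrict-≡-if-differences-outside T {r} {r'} outside = restrict-cong T agree
  where
  agree : ∀ k → k ∈ T → lookup r k ≡ lookup r' k
  agree k k∈T with lookup r k B.≟ lookup r' k
  ... | yes eq = eq
  ... | no neq = contradiction k∈T (outside k neq)

restrict-∁-injective : ∀ {n} (S : Subset n) {r r' : Outcome n} →
  restrict S r ≡ restrict S r' → restrict (∁ S) r ≡ restrict (∁ S) r' → r ≡ r'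
restrict-∁-injective []          {[]}    {[]}     _  _  = refl
restrict-∁-injective (true  ∷ S) {_ ∷ _} {_ ∷ _} eq eq' =
  let head≡ , tail≡ = ∷-injective eq in cong₂ _∷_ head≡ (restrict-∁-injective S tail≡ eq')
restrict-∁-injective (false ∷ S) {_ ∷ _} {_ ∷ _} eq eq' =
  let head≡ , tail≡ = ∷-injective eq' in cong₂ _∷_ head≡ (restrict-∁-injective S eq tail≡)

another-block : ∀ {n} (S : Subset n) → S ≢ ⊤ →
                (x : Outcome n) → ∃ λ y → restrict (∁ S) y ≢ restrict (∁ S) x
another-block []          S≢⊤ []      = ⊥-elim (S≢⊤ refl)
another-block (false ∷ S) _   (b ∷ x) = not b ∷ x , not-¬ refl ∘ sym ∘ ∷-injectiveˡ
another-block (true  ∷ S) S≢⊤ (b ∷ x) =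
  let y , y≢x = another-block S (S≢⊤ ∘ cong (true ∷_)) x in b ∷ y , y≢x

restrict-≡-if-bit-∉ : ∀ {n} (T : Subset n) {r r' : Outcome n} (d : DifferInExactlyOne r r') →
                      proj₁ d ∉ T → restrict T r ≡ restrict T r'
restrict-≡-if-bit-∉ T (i , _ , only-i) i∉T =
  restrict-≡-if-differences-outside T λ k neq → subst (_∉ T) (sym (only-i k neq)) i∉T

record FirstExit {a r p} {A : Set a} (R : Rel A r) (P : Pred A p) (xs : List A) : Set (a ⊔ r ⊔ p) where
  field
    prefix suffix : List A
    last first    : A
    split         : xs ≡ prefix ++ last ∷ first ∷ suffix
    prefix-in     : All P prefix
    last-in       : P last
    first-out     : ¬ P first
    step          : R last first

first-exit : ∀ {a r p} {A : Set a} {R : Rel A r} {P : Pred A p} → Decidable P →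
             ∀ {x xs} → Linked R (x ∷ xs) → P x → ∃ (λ w → w ∈ᴸ x ∷ xs × ¬ P w) →
             FirstExit R P (x ∷ xs)
first-exit P? [-] Px (_ , Any.here refl , ¬Px) = contradiction Px ¬Px
first-exit {P = P} P? {x} {y ∷ ys} (Rxy ∷ linked) Px (w , w∈ , ¬Pw) with P? y
... | no ¬Py = record
  { prefix = [] ; suffix = ys ; last = x ; first = y ; split = refl
  ; prefix-in = [] ; last-in = Px ; first-out = ¬Py ; step = Rxy }
... | yes Py = record
  { prefix = x ∷ prefix ; split = cong (x ∷_) split ; prefix-in = Px ∷ prefix-in
  ; suffix = suffix ; last = last ; first = first ; last-in = last-in
  ; first-out = first-out ; step = step }
  where
  w-later : ∀ {z} → z ∈ᴸ x ∷ y ∷ ys → ¬ P z → z ∈ᴸ y ∷ ys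
  w-later (Any.here refl) ¬Pz = contradiction Px ¬Pz
  w-later (Any.there z∈ys) _  = z∈ys
  open FirstExit (first-exit P? linked Py (w , w-later w∈ ¬Pw , ¬Pw))

InBlock : ∀ {n} → Subset n → Outcome n → Pred (Outcome n) _
InBlock S x r = restrict (∁ S) r ≡ restrict (∁ S) x

inBlock? : ∀ {n} (S : Subset n) (x : Outcome n) → Decidable (InBlock S x)
inBlock? S x r = ≡-dec B._≟_ (restrict (∁ S) r) (restrict (∁ S) x)

module _ {n} (S : Subset n) {x : Outcome n} where

  subMatrix-take : ∀ {r} (P : List (Outcome n)) → InBlock S x r →
                   subMatrix (r ∷ P) S x ≡ restrict S r ∷ subMatrix P S x
  subMatrix-take P r-in = cong (map (restrict S)) (filter-accept (inBlock? S x) r-in)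

  subMatrix-skip : ∀ {r} (P : List (Outcome n)) → ¬ InBlock S x r →
                   subMatrix (r ∷ P) S x ≡ subMatrix P S x
  subMatrix-skip P r-out = cong (map (restrict S)) (filter-reject (inBlock? S x) r-out)

  subMatrix-skip-all : ∀ {pre} (P : List (Outcome n)) → All (¬_ ∘ InBlock S x) pre →
                       subMatrix (pre ++ P) S x ≡ subMatrix P S x
  subMatrix-skip-all P []                        = refl
  subMatrix-skip-all P (_∷_ {xs = pre} r-out pre-out) =
    trans (subMatrix-skip (pre ++ P) r-out) (subMatrix-skip-all P pre-out)

second-row-leaves-first-block :
  ∀ {n} {P : List (Outcome n)} {S : Subset n} → InCG n P → S ≢ ⊤ →
  (∀ x y → subMatrix P S x ≡ subMatrix P S y) →
  ∀ {r₀ r₁ rest} → P ≡ r₀ ∷ r₁ ∷ rest → ¬ InBlock S r₀ r₁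
second-row-leaves-first-block {S = S} ((_ , r₀-unique ∷ _ , complete) , _ ∷ linked) S≢⊤ sep
                              {r₀} {r₁} {rest} refl r₁-in =
  All.lookup r₀-unique u∈ (sym u≡r₀)
  where
  other-block : ∃ λ w → w ∈ᴸ r₁ ∷ rest × ¬ InBlock S r₀ w
  other-block with another-block S S≢⊤ r₀
  ... | w , w-out with complete w
  ...   | Any.here refl = contradiction refl w-out
  ...   | Any.there w∈  = w , w∈ , w-out

  open FirstExit (first-exit (inBlock? S r₀) linked r₁-in other-block)
    renaming (last to u; first to v)

  u∈ : u ∈ᴸ r₁ ∷ rest
  u∈ = subst (u ∈ᴸ_) (sym split) (∈-++⁺ʳ prefix (Any.here refl))

  not-in-v's-block : ∀ {r} → InBlock S r₀ r → ¬ InBlock S v r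
  not-in-v's-block r-in r-in-v = first-out (trans (sym r-in-v) r-in)

  -- v heads its own block, and by separability every block has the head of r₀'s block.
  v≈r₀-on-S : restrict S v ≡ restrict S r₀
  v≈r₀-on-S = ∷-injectiveˡ (begin
    restrict S v ∷ subMatrix suffix S v               ≡⟨ sym (subMatrix-take S suffix refl) ⟩
    subMatrix (v ∷ suffix) S v                        ≡⟨ sym (subMatrix-skip S (v ∷ suffix) (not-in-v's-block last-in)) ⟩
    subMatrix (u ∷ v ∷ suffix) S v                    ≡⟨ sym (subMatrix-skip-all S (u ∷ v ∷ suffix)
                                                            (All.map not-in-v's-block (refl ∷ prefix-in))) ⟩
    subMatrix (r₀ ∷ prefix ++ u ∷ v ∷ suffix) S v     ≡⟨ cong (λ P → subMatrix (r₀ ∷ P) S v) (sym split) ⟩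
    subMatrix (r₀ ∷ r₁ ∷ rest) S v                    ≡⟨ sep v r₀ ⟩
    subMatrix (r₀ ∷ r₁ ∷ rest) S r₀                   ≡⟨ subMatrix-take S (r₁ ∷ rest) refl ⟩
    restrict S r₀ ∷ subMatrix (r₁ ∷ rest) S r₀        ∎)
    where open ≡-Reasoning

  u≈v-on-S : restrict S u ≡ restrict S v
  u≈v-on-S = restrict-≡-if-bit-∉ S step bit∉S
    where
    bit∉S : proj₁ step ∉ S
    bit∉S bit∈S = first-out (trans (sym (restrict-≡-if-bit-∉ (∁ S) step (x∈p⇒x∉∁p bit∈S))) last-in)

  u≡r₀ : u ≡ r₀
  u≡r₀ = restrict-∁-injective S (trans u≈v-on-S v≈r₀-on-S) last-in

lemma5 : (n : ℕ) (P : List (Outcome n)) (S : Subset n) →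
         InCG n P → Nonempty S → S ≢ ⊤ → Separable S P →
         (r₀ r₁ : Outcome n) (rest : List (Outcome n)) → P ≡ r₀ ∷ r₁ ∷ rest →
         (j : Fin n) → lookup r₀ j ≢ lookup r₁ j → j ∉ S
lemma5 n P S _ (_ , s∈S) _ (inj₁ (inj₁ refl)) _ _ _ _ _ _ = contradiction s∈S ∉⊥
lemma5 n P S _ _ S≢⊤ (inj₁ (inj₂ S≡⊤)) _ _ _ _ _ _ = contradiction S≡⊤ S≢⊤
lemma5 n P S cg@(_ , d ∷ _) _ S≢⊤ (inj₂ sep) r₀ r₁ rest refl j r₀≢r₁ j∈S =
  second-row-leaves-first-block cg S≢⊤ sep refl (sym (restrict-≡-if-bit-∉ (∁ S) d bit∉∁S))
  where
  bit∉∁S : proj₁ d ∉ ∁ S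
  bit∉∁S = x∈p⇒x∉∁p (subst (_∈ S) (proj₂ (proj₂ d) j r₀≢r₁) j∈S)
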